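{- Let $b,c$ be bounding functions. Let $T$ be a bounded and balanced $(b,c)$-bushy (length 2) tree system above $(\sigma,\mu)$, and let $B\subset T$ be open in $T$ and $(b,c)$-small above $(\sigma,\mu)$. Then for every $m$ there is some $(\tau,\rho)\in T$ with $|\tau|,|\rho|\ge m$ above which $B$ is $(b,c)$-small.
   Context: A bounding function is a computable function $\omega\to[2,\omega)$. Strings are elements of $\omega^{<\omega}$; $\sigma^{\preceq}$ is the set of strings extending $\sigma$. A tree above $\sigma$ is a nonempty subset of $\sigma^{\preceq}$ closed under initial segments of length $\ge|\sigma|$; a leaf is an element with no proper extension in the tree; a tree is $h$-bushy if every non-leaf $\tau$ has at least $h(|\tau|)$ immediate successors in it. A tree $S'$ end-extends a finite tree $S$ if $S\subseteq S'$ and every string in $S'\setminus S$ extends a leaf of $S$. For a set $A$ of pairs of strings, $A(\tau)=\{\rho:(\tau,\rho)\in A\}$, $\operatorname{dom}A=\{\tau:A(\tau)\neq\emptyset\}$. A tree system above $(\sigma,\mu)$ is a set $T$ of pairs such that $\operatorname{dom}T$ is a tree above $\sigma$, each $T(\tau)$ is a finite tree above $\mu$, and $T(\tau')$ end-extends $T(\tau)$ whenever $\tau\prec\tau'$ are in $\operatorname{dom}T$; leaves of $T$ are pairs $(\tau,\rho)$ with $\tau$ a leaf of $\operatorname{dom}T$ and $\rho$ a leaf of $T(\tau)$; $T$ is $(b,c)$-bushy if $\operatorname{dom}T$ is $b$-bushy and each $T(\tau)$ is $c$-bushy; $T$ is bounded if some function bounds all entries of all strings appearing in $T$. A level $m$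 is balanced for $T$ if for all $\tau\in\operatorname{dom}T$ of length $m$, every leaf of $T(\tau)$ has length $m$; $T$ is balanced if $\operatorname{dom}T$ has no leaves and $T$ has infinitely many balanced levels. Pairs are ordered by $(\tau,\rho)\preceq(\tau',\rho')$ iff $\tau\preceq\tau'$ and $\rho\preceq\rho'$; $B\subseteq T$ is open in $T$ if it is upward closed within $T$. A set $B$ of pairs is $(b,c)$-big above a pair $(\tau,\rho)$ if there is a finite $(b,c)$-bushy tree system above $(\tau,\rho)$ all of whose leaves lie in $B$; otherwise it is $(b,c)$-small above $(\tau,\rho)$. -}

module Defs where

open import Level using (0ℓ)
open import Data.Nat using (ℕ; _≤_; _<_)
open import Data.Fin using (Fin; fromℕ<)
open import Data.List using (List; []; _∷_; _++_; [_]; length; lookup)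
open import Data.List.Membership.Propositional using (_∈_)
open import Data.Product using (Σ; ∃; _×_; _,_)
open import Relation.Binary.PropositionalEquality using (_≡_; _≢_)
open import Relation.Nullary using (¬_)
open import Function.Definitions using (Injective)

Str : Set
Str = List ℕ

_≼_ : Str → Str → Set
σ ≼ τ = ∃ λ ν → σ ++ ν ≡ τ

StrSet : Set₁
StrSet = Str → Set

PairSet : Set₁
PairSet = Str → Str → Set      -- A τ ρ  means (τ , ρ) ∈ A ; A τ is A(τ)

IsBoundingFunction : (ℕ → ℕ) → Set
IsBoundingFunction h = ∀ n → 2 ≤ h n

FiniteStr : StrSet → Set
FiniteStr S = ∃ λ (l : List Str) → ∀ x → S x → x ∈ l

IsTreeAbove : StrSet → Str → Set
IsTreeAbove S σ =
  (∃ λ τ → S τ)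
  × (∀ τ → S τ → σ ≼ τ)
  × (∀ τ τ' → S τ' → τ ≼ τ' → length σ ≤ length τ → S τ)

Leaf : StrSet → Str → Set
Leaf S τ = S τ × (∀ τ' → S τ' → τ ≼ τ' → τ' ≡ τ)

AtLeast : ℕ → (ℕ → Set) → Set
AtLeast k P = ∃ λ (f : Fin k → ℕ) → Injective _≡_ _≡_ f × (∀ i → P (f i))

Bushy : (ℕ → ℕ) → StrSet → Set
Bushy h S = ∀ τ → S τ → ¬ Leaf S τ → AtLeast (h (length τ)) (λ n → S (τ ++ [ n ]))

EndExtends : StrSet → StrSet → Set
EndExtends S' S =
  (∀ x → S x → S' x)
  × (∀ x → S' x → ¬ S x → ∃ λ ℓ → Leaf S ℓ × ℓ ≼ x)

dom : PairSet → StrSet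
dom A τ = ∃ λ ρ → A τ ρ

IsTreeSystem : PairSet → Str → Str → Set
IsTreeSystem T σ μ =
  IsTreeAbove (dom T) σ
  × (∀ τ → dom T τ → IsTreeAbove (T τ) μ × FiniteStr (T τ))
  × (∀ τ τ' → dom T τ → dom T τ' → τ ≼ τ' → τ ≢ τ' → EndExtends (T τ') (T τ))

LeafSys : PairSet → Str → Str → Set
LeafSys T τ ρ = Leaf (dom T) τ × Leaf (T τ) ρ

Bushy2 : (ℕ → ℕ) → (ℕ → ℕ) → PairSet → Set
Bushy2 b c T = Bushy b (dom T) × (∀ τ → dom T τ → Bushy c (T τ))

BoundedBy : (ℕ → ℕ) → Str → Set
BoundedBy g σ = ∀ i (p : i < length σ) → lookup σ (fromℕ< p) < g i

BoundedSys : PairSet → Set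
BoundedSys T = ∃ λ (g : ℕ → ℕ) → ∀ τ ρ → T τ ρ → BoundedBy g τ × BoundedBy g ρ

BalancedLevel : PairSet → ℕ → Set
BalancedLevel T m =
  ∀ τ → dom T τ → length τ ≡ m → ∀ ρ → Leaf (T τ) ρ → length ρ ≡ m

Balanced : PairSet → Set
Balanced T =
  (∀ τ → ¬ Leaf (dom T) τ)
  × (∀ n → ∃ λ m → n ≤ m × BalancedLevel T m)

_⊆₂_ : PairSet → PairSet → Set
B ⊆₂ T = ∀ τ ρ → B τ ρ → T τ ρ

OpenIn : PairSet → PairSet → Set
OpenIn B T = ∀ τ ρ τ' ρ' → B τ ρ → T τ' ρ' → τ ≼ τ' → ρ ≼ ρ' → B τ' ρ'

FinitePair : PairSet → Set
FinitePair S = ∃ λ (l : List (Str × Str)) → ∀ τ ρ → S τ ρ → (τ , ρ) ∈ l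

Big : (ℕ → ℕ) → (ℕ → ℕ) → PairSet → Str → Str → Set₁
Big b c B τ ρ = Σ PairSet λ S →
  FinitePair S × IsTreeSystem S τ ρ × Bushy2 b c S
  × (∀ τ' ρ' → LeafSys S τ' ρ' → B τ' ρ')

Small : (ℕ → ℕ) → (ℕ → ℕ) → PairSet → Str → Str → Set₁
Small b c B τ ρ = ¬ Big b c B τ ρ

module Submission where

open import Defs
open import Level using (0ℓ; Lift; lift; lower) renaming (suc to lsuc)
open import Data.Nat using (ℕ; zero; suc; _≤_; _<_; _+_; _⊔_; z≤n; s≤s)
open import Data.Nat.Properties
open import Data.Fin using (Fin; fromℕ<)
open import Data.List using (List; []; _∷_; _++_; [_]; length; map; concatMap; foldr; upTo)
open import Data.List.Properties using (++-identityʳ; ++-assoc; length-++; ∷-injective; ≡-dec)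
open import Data.List.Membership.Propositional using (_∈_; lose)
open import Data.List.Membership.Propositional.Properties
  using (∈-++⁺ˡ; ∈-++⁺ʳ; ∈-map⁺; ∈-concatMap⁺; ∈-upTo⁺)
open import Data.List.Relation.Unary.Any using (here; there)
open import Data.Product using (Σ; ∃; _×_; _,_; proj₁; proj₂)
open import Data.Sum using (_⊎_; inj₁; inj₂)
open import Data.Empty using (⊥; ⊥-elim)
open import Relation.Binary.PropositionalEquality using (_≡_; _≢_; refl; sym; trans; cong; cong₂; subst)
open import Relation.Nullary using (¬_; Dec; yes; no)
open import Axiom.ExcludedMiddle using (ExcludedMiddle)

-- Lemma 3.17.  We argue classically, by contraposition.  Pick a balanced level
-- m' ≥ m + |σ| of T and suppose B is (b,c)-big above every (τ,ρ) ∈ T with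
-- |τ|,|ρ| ≥ m'; we build a finite bushy tree system above (σ,μ) with leaves in B.
--
-- The central notion is a witness over a finite tree R above μ at τ: a finite
-- (b,c)-bushy tree system above (τ,μ) with all leaves in B whose root fibre
-- end-extends R.  Witnesses are produced in three ways:
--   * singleton: if all leaves ρ of R satisfy B τ ρ, the system {τ} × R;
--   * grafting:  if every domain leaf τ₁ of a system S carries a witness over
--                S τ₁, gluing these on top of S gives a witness over S τ₀;
--   * widening:  for a leaf ρ* of R and a system S above (τ,ρ*), the fibres
--                R ∪ S τ' form a system above (τ,μ) end-extending R.
-- Resolving the leaves of a fibre one by one (induction on a list covering
-- them) combines these, and grafting onto T truncated at level m' — finite since
-- T is bounded, with all leaves at length m' since the level is balanced —
-- yields bigness above (σ,μ), contradicting smallness.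

≼-refl : ∀ σ → σ ≼ σ
≼-refl σ = [] , ++-identityʳ σ

≼-trans : ∀ {σ τ ρ} → σ ≼ τ → τ ≼ ρ → σ ≼ ρ
≼-trans {σ} (ν , refl) (ν' , refl) = ν ++ ν' , sym (++-assoc σ ν ν')

≼-snoc : ∀ τ n → τ ≼ (τ ++ [ n ])
≼-snoc τ n = [ n ] , refl

length-snoc : ∀ τ (n : ℕ) → length (τ ++ [ n ]) ≡ suc (length τ)
length-snoc τ n = trans (length-++ τ) (+-comm (length τ) 1)

≼⇒length≤ : ∀ {σ τ} → σ ≼ τ → length σ ≤ length τ
≼⇒length≤ {σ} (ν , refl) rewrite length-++ σ {ν} = m≤m+n (length σ) (length ν)

≼∧length≥⇒≡ : ∀ {σ τ} → σ ≼ τ → length τ ≤ length σ → σ ≡ τ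
≼∧length≥⇒≡ {σ} ([] , refl) _ = sym (++-identityʳ σ)
≼∧length≥⇒≡ {σ} (x ∷ ν , refl) le rewrite length-++ σ {x ∷ ν} =
  ⊥-elim (<⇒≱ (m<m+n (length σ) {suc (length ν)} (s≤s z≤n)) le)

≼-strict : ∀ {σ τ} → σ ≼ τ → σ ≢ τ → length σ < length τ
≼-strict p σ≢τ = ≤∧≢⇒< (≼⇒length≤ p) (λ e → σ≢τ (≼∧length≥⇒≡ p (≤-reflexive (sym e))))

≼-antisym : ∀ {σ τ} → σ ≼ τ → τ ≼ σ → σ ≡ τ
≼-antisym p q = ≼∧length≥⇒≡ p (≼⇒length≤ q)

≼-comparable : ∀ σ τ {x} → σ ≼ x → τ ≼ x → length σ ≤ length τ → σ ≼ τ
≼-comparable [] τ _ _ _ = τ , refl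
≼-comparable (a ∷ σ) (a' ∷ τ) (ν , e) (ν' , e') (s≤s le) with ∷-injective (trans e (sym e'))
... | a≡a' , tails with ≼-comparable σ τ (ν , tails) (ν' , refl) le
... | ρ , p = ρ , cong₂ _∷_ a≡a' p

leaf-unique : ∀ (D : StrSet) {τ₁ τ₂ x} → Leaf D τ₁ → Leaf D τ₂ → τ₁ ≼ x → τ₂ ≼ x → τ₁ ≡ τ₂
leaf-unique D {τ₁} {τ₂} l₁ l₂ p₁ p₂ with ≤-total (length τ₁) (length τ₂)
... | inj₁ le = sym (proj₂ l₁ τ₂ (proj₁ l₂) (≼-comparable τ₁ τ₂ p₁ p₂ le))
... | inj₂ le = proj₂ l₂ τ₁ (proj₁ l₁) (≼-comparable τ₂ τ₁ p₂ p₁ le)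

-- Extensional equality of sets of strings.  The fibres of the systems built
-- below are only extensionally equal to the trees they are made from, and all
-- notions of Defs are invariant under it.

_≐_ : StrSet → StrSet → Set
S ≐ S' = ∀ x → (S x → S' x) × (S' x → S x)

≐-refl : ∀ {S} → S ≐ S
≐-refl x = (λ s → s) , (λ s → s)

≐-sym : ∀ {S S'} → S ≐ S' → S' ≐ S
≐-sym e x = proj₂ (e x) , proj₁ (e x)

Leaf-≐ : ∀ {S S'} → S ≐ S' → ∀ {x} → Leaf S x → Leaf S' x
Leaf-≐ e {x} (sx , maximal) = proj₁ (e x) sx , λ y s'y p → maximal y (proj₂ (e y) s'y) p

Tree-≐ : ∀ {S S'} → S ≐ S' → ∀ {σ} → IsTreeAbove S σ → IsTreeAbove S' σ
Tree-≐ e ((τ , sτ) , above , closed) =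
  (τ , proj₁ (e τ) sτ) , (λ τ' s → above τ' (proj₂ (e τ') s)) ,
  λ τ' τ'' s p l → proj₁ (e τ') (closed τ' τ'' (proj₂ (e τ'') s) p l)

Finite-≐ : ∀ {S S'} → S ≐ S' → FiniteStr S → FiniteStr S'
Finite-≐ e (l , covers) = l , λ x s → covers x (proj₂ (e x) s)

AtLeast-map : ∀ {k} {P Q : ℕ → Set} → (∀ n → P n → Q n) → AtLeast k P → AtLeast k Q
AtLeast-map h (f , injective , holds) = f , injective , λ i → h (f i) (holds i)

Bushy-≐ : ∀ {h : ℕ → ℕ} {S S' : StrSet} → S ≐ S' → Bushy h S → Bushy h S'
Bushy-≐ e bushy τ s ¬leaf =
  AtLeast-map (λ n → proj₁ (e (τ ++ [ n ])))
    (bushy τ (proj₂ (e τ) s) (λ l → ¬leaf (Leaf-≐ e l)))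

EndExtends-≐ : ∀ {A A' C C'} → A ≐ A' → C ≐ C' → EndExtends A C → EndExtends A' C'
EndExtends-≐ eA eC (sub , new) =
  (λ x c → proj₁ (eA x) (sub x (proj₂ (eC x) c))) ,
  λ x a ¬c → let (ℓ , leaf , p) = new x (proj₂ (eA x) a) (λ c → ¬c (proj₁ (eC x) c))
             in ℓ , Leaf-≐ eC leaf , p

EndExtends-refl : ∀ {A} → EndExtends A A
EndExtends-refl = (λ x a → a) , λ x a ¬a → ⊥-elim (¬a a)

tree-above : ∀ {S σ} → IsTreeAbove S σ → ∀ τ → S τ → σ ≼ τ
tree-above (_ , above , _) = above

tree-closed : ∀ {S σ} → IsTreeAbove S σ →
              ∀ τ τ' → S τ' → τ ≼ τ' → length σ ≤ length τ → S τ
tree-closed (_ , _ , closed) = closed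

tree-root : ∀ {S σ} → IsTreeAbove S σ → S σ
tree-root {σ = σ} t@((τ , sτ) , _) = tree-closed t σ τ sτ (tree-above t τ sτ) ≤-refl

extends-≼ : ∀ {S : PairSet} →
  (∀ τ₁ τ₂ → dom S τ₁ → dom S τ₂ → τ₁ ≼ τ₂ → τ₁ ≢ τ₂ → EndExtends (S τ₂) (S τ₁)) →
  ∀ τ₁ τ₂ → dom S τ₁ → dom S τ₂ → τ₁ ≼ τ₂ → EndExtends (S τ₂) (S τ₁)
extends-≼ extends τ₁ τ₂ d₁ d₂ p with ≡-dec _≟_ τ₁ τ₂
... | yes refl = EndExtends-refl
... | no τ₁≢τ₂ = extends τ₁ τ₂ d₁ d₂ p τ₁≢τ₂

∈-concatMap : ∀ {A C : Set} (f : A → List C) {x y xs} → x ∈ xs → y ∈ f x → y ∈ concatMap f xs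
∈-concatMap f {y = y} x∈xs y∈fx = ∈-concatMap⁺ f (lose {P = λ a → y ∈ f a} x∈xs y∈fx)

pairsOver : List Str → (Str → List Str) → List (Str × Str)
pairsOver τs fibre = concatMap (λ τ → map (τ ,_) (fibre τ)) τs

∈-pairsOver : ∀ {τs fibre τ ρ} → τ ∈ τs → ρ ∈ fibre τ → (τ , ρ) ∈ pairsOver τs fibre
∈-pairsOver {fibre = fibre} {τ} τ∈ ρ∈ =
  ∈-concatMap (λ τ' → map (τ' ,_) (fibre τ')) τ∈ (∈-map⁺ (τ ,_) ρ∈)

maxLength : List Str → ℕ
maxLength = foldr (λ s m → length s ⊔ m) 0

length≤maxLength : ∀ {x} l → x ∈ l → length x ≤ maxLength l
length≤maxLength (y ∷ l) (here refl) = m≤m⊔n (length y) (maxLength l)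
length≤maxLength (y ∷ l) (there p) = ≤-trans (length≤maxLength l p) (m≤n⊔m (length y) (maxLength l))

-- All strings of length at most N whose entries are bounded by g; this is what
-- makes a bounded tree system truncated at a fixed level finite.
boundedStrings : (ℕ → ℕ) → ℕ → List Str
boundedStrings g zero = [ [] ]
boundedStrings g (suc N) =
  [] ∷ concatMap (λ a → map (a ∷_) (boundedStrings (λ i → g (suc i)) N)) (upTo (g 0))

boundedStrings-complete : ∀ g N τ → length τ ≤ N → BoundedBy g τ → τ ∈ boundedStrings g N
boundedStrings-complete g zero [] _ _ = here refl
boundedStrings-complete g (suc N) [] _ _ = here refl
boundedStrings-complete g (suc N) (a ∷ τ) (s≤s le) bounded =
  there (∈-concatMap (λ a' → map (a' ∷_) (boundedStrings (λ i → g (suc i)) N))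
    (∈-upTo⁺ (bounded 0 (s≤s z≤n)))
    (∈-map⁺ (a ∷_) (boundedStrings-complete (λ i → g (suc i)) N τ le
                      (λ i p → bounded (suc i) (s≤s p)))))

_∪_ : StrSet → StrSet → StrSet
(R ∪ X) ρ = R ρ ⊎ X ρ

widened : StrSet → PairSet → PairSet
widened R S τ ρ = dom S τ × (R ∪ S τ) ρ

∪-finite : ∀ {R X} → FiniteStr R → FiniteStr X → FiniteStr (R ∪ X)
∪-finite (lR , coverR) (lX , coverX) = lR ++ lX , covers
  where
  covers : ∀ x → _ → x ∈ lR ++ lX
  covers x (inj₁ r) = ∈-++⁺ˡ (coverR x r)
  covers x (inj₂ y) = ∈-++⁺ʳ lR (coverX x y)

widened≐ : ∀ {R S τ} → dom S τ → widened R S τ ≐ (R ∪ S τ)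
widened≐ d ρ = proj₂ , (λ u → d , u)

module Classical (em : ExcludedMiddle (lsuc 0ℓ)) where

  decide : (P : Set) → Dec P
  decide P with em {Lift (lsuc 0ℓ) P}
  ... | yes p = yes (lower p)
  ... | no ¬p = no (λ p → ¬p (lift p))

  ¬¬-elim : {P : Set₁} → ¬ ¬ P → P
  ¬¬-elim {P} ¬¬p with em {P}
  ... | yes p = p
  ... | no ¬p = ⊥-elim (¬¬p ¬p)

  -- End-extension is transitive: a new string of A is either new over C, hence
  -- above a leaf of C, or lies in C and is then new over D.
  EndExtends-trans : ∀ {A C D} → EndExtends A C → EndExtends C D → EndExtends A D
  EndExtends-trans {A} {C} {D} (C⊆A , newA) (D⊆C , newC) = (λ x d → C⊆A x (D⊆C x d)) , new
    where
    new : ∀ x → A x → ¬ D x → ∃ λ ℓ → Leaf D ℓ × ℓ ≼ x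
    new x a ¬d with decide (C x)
    ... | yes c = newC x c ¬d
    ... | no ¬c with newA x a ¬c
    ... | ℓ , (cℓ , maximal) , ℓ≼x with decide (D ℓ)
    ...   | yes dℓ = ℓ , (dℓ , λ y dy p → maximal y (D⊆C y dy) p) , ℓ≼x
    ...   | no ¬dℓ with newC ℓ cℓ ¬dℓ
    ...     | ℓ' , leaf' , ℓ'≼ℓ = ℓ' , leaf' , ≼-trans ℓ'≼ℓ ℓ≼x

  -- Every element of a finite set of strings lies below one of its leaves:
  -- climb along proper extensions, whose lengths are bounded by a covering list.
  leafAbove : ∀ (S : StrSet) → FiniteStr S → ∀ x → S x → ∃ λ y → Leaf S y × x ≼ y
  leafAbove S (l , covers) x sx =
    climb (suc (maxLength l)) x sx (≤-trans (n<1+n (maxLength l)) (m≤m+n _ _))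
    where
    climb : ∀ fuel x → S x → maxLength l < fuel + length x → ∃ λ y → Leaf S y × x ≼ y
    climb zero x sx lt = ⊥-elim (<⇒≱ lt (length≤maxLength l (covers x sx)))
    climb (suc k) x sx lt with decide (∃ λ y → S y × x ≼ y × y ≢ x)
    ... | yes (y , sy , x≼y , y≢x) with climb k y sy (≤-trans lt longer)
      where
      longer : suc k + length x ≤ k + length y
      longer = ≤-trans (≤-reflexive (sym (+-suc k (length x))))
                       (+-monoʳ-≤ k (≼-strict x≼y (λ e → y≢x (sym e))))
    ...   | z , leaf , y≼z = z , leaf , ≼-trans x≼y y≼z
    climb (suc k) x sx lt | no none = x , (sx , maximal) , ≼-refl x
      where
      maximal : ∀ y → S y → x ≼ y → y ≡ x
      maximal y sy x≼y with ≡-dec _≟_ y x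
      ... | yes y≡x = y≡x
      ... | no y≢x = ⊥-elim (none (y , sy , x≼y , y≢x))

  ∪-leaf : ∀ {R X ρ} → Leaf (R ∪ X) ρ → Leaf X ρ ⊎ (Leaf R ρ × ¬ X ρ)
  ∪-leaf {R} {X} {ρ} (uρ , maximal) with decide (X ρ)
  ... | yes xρ = inj₁ (xρ , λ y xy p → maximal y (inj₂ xy) p)
  ... | no ¬xρ with uρ
  ...   | inj₁ rρ = inj₂ ((rρ , λ y ry p → maximal y (inj₁ ry) p) , ¬xρ)
  ...   | inj₂ xρ = ⊥-elim (¬xρ xρ)

  widened-leaf : ∀ {R S τ ρ} → dom S τ → Leaf (widened R S τ) ρ → Leaf (S τ) ρ ⊎ (Leaf R ρ × ¬ S τ ρ)
  widened-leaf {R} {S} d leaf = ∪-leaf (Leaf-≐ (widened≐ {R} {S} d) leaf)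

module Systems (b c : ℕ → ℕ) where

  record BushySystem (S : PairSet) (τ ρ : Str) : Set where
    field
      finite       : FinitePair S
      domTree      : IsTreeAbove (dom S) τ
      fibres       : ∀ τ' → dom S τ' → IsTreeAbove (S τ') ρ × FiniteStr (S τ')
      fibreExtends : ∀ τ₁ τ₂ → dom S τ₁ → dom S τ₂ → τ₁ ≼ τ₂ → τ₁ ≢ τ₂ →
                     EndExtends (S τ₂) (S τ₁)
      domBushy     : Bushy b (dom S)
      fibreBushy   : ∀ τ' → dom S τ' → Bushy c (S τ')

    fibreTree : ∀ τ' → dom S τ' → IsTreeAbove (S τ') ρ
    fibreTree τ' d = proj₁ (fibres τ' d)

    fibreFinite : ∀ τ' → dom S τ' → FiniteStr (S τ')
    fibreFinite τ' d = proj₂ (fibres τ' d)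

  open BushySystem public

  LeavesIn : PairSet → PairSet → Set
  LeavesIn B S = ∀ τ ρ → LeafSys S τ ρ → B τ ρ

  big→system : ∀ {B τ ρ} → Big b c B τ ρ → Σ PairSet λ S → BushySystem S τ ρ × LeavesIn B S
  big→system (S , fin , (dT , fs , ext) , (bd , bc) , inB) =
    S , record { finite = fin ; domTree = dT ; fibres = fs ; fibreExtends = ext
               ; domBushy = bd ; fibreBushy = bc } , inB

  system→big : ∀ {B S τ ρ} → BushySystem S τ ρ → LeavesIn B S → Big b c B τ ρ
  system→big {S = S} sys inB =
    S , finite sys , (domTree sys , fibres sys , fibreExtends sys) ,
    (domBushy sys , fibreBushy sys) , inB

module Witnesses (em : ExcludedMiddle (lsuc 0ℓ)) (b c : ℕ → ℕ) (B : PairSet) (μ : Str) where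
  open Classical em
  open Systems b c

  record Witness (S : PairSet) (τ : Str) (R : StrSet) : Set where
    field
      system      : BushySystem S τ μ
      leavesInB   : LeavesIn B S
      rootExtends : EndExtends (S τ) R

  open Witness public

  BigOver : Str → StrSet → Set₁
  BigOver τ R = Σ PairSet λ S → Witness S τ R

  BigOver-weaken : ∀ {τ R R'} → EndExtends R' R → BigOver τ R' → BigOver τ R
  BigOver-weaken R'⊒R (S , w) =
    S , record { system = system w ; leavesInB = leavesInB w
               ; rootExtends = EndExtends-trans (rootExtends w) R'⊒R }

  singleton : ∀ τ {R} → IsTreeAbove R μ → FiniteStr R → Bushy c R →
              (∀ ρ → Leaf R ρ → B τ ρ) → BigOver τ R
  singleton τ {R} tR fR bR inB = Z , record
    { system = record
        { finite = pairsOver [ τ ] (λ _ → proj₁ fR) ,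
                   λ { τ' ρ (refl , r) → ∈-pairsOver {τs = [ τ ]} (here refl) (proj₂ fR ρ r) }
        ; domTree = (τ , ρ₀ , refl , r₀) , (λ { τ' (_ , refl , _) → ≼-refl τ }) ,
                    λ { y τ' (_ , refl , _) p l → ρ₀ , ≼∧length≥⇒≡ p l , r₀ }
        ; fibres = λ { τ' (_ , refl , _) → Tree-≐ (≐-sym Zτ≐R) tR , Finite-≐ (≐-sym Zτ≐R) fR }
        ; fibreExtends = λ { τ₁ τ₂ (_ , refl , _) (_ , refl , _) _ τ≢τ → ⊥-elim (τ≢τ refl) }
        ; domBushy = λ τ' d ¬leaf → ⊥-elim (¬leaf (onlyPoint τ' d))
        ; fibreBushy = λ { τ' (_ , refl , _) → Bushy-≐ {c} (≐-sym Zτ≐R) bR } }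
    ; leavesInB = λ { τ' ρ (((_ , refl , _) , _) , leaf) → inB ρ (Leaf-≐ Zτ≐R leaf) }
    ; rootExtends = (λ ρ r → refl , r) , λ ρ (_ , r) ¬r → ⊥-elim (¬r r) }
    where
    Z : PairSet
    Z τ' ρ = τ' ≡ τ × R ρ
    Zτ≐R : Z τ ≐ R
    Zτ≐R ρ = proj₂ , (λ r → refl , r)
    ρ₀ = proj₁ (proj₁ tR)
    r₀ = proj₂ (proj₁ tR)
    onlyPoint : ∀ τ' → dom Z τ' → Leaf (dom Z) τ'
    onlyPoint τ' d@(_ , refl , _) = d , λ { y (_ , refl , _) p → refl }

  module Grafting {S : PairSet} {τ₀ : Str} (sys : BushySystem S τ₀ μ)
                  (witnessAt : ∀ τ₁ → Leaf (dom S) τ₁ → BigOver τ₁ (S τ₁)) where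

    IsLeaf : Str → Set
    IsLeaf = Leaf (dom S)

    -- The system grafted at τ₁, chosen once for all proofs that τ₁ is a leaf.
    graftAt : ∀ τ₁ → Dec (IsLeaf τ₁) → PairSet
    graftAt τ₁ (yes l) = proj₁ (witnessAt τ₁ l)
    graftAt τ₁ (no _) = λ _ _ → ⊥

    W : Str → PairSet
    W τ₁ = graftAt τ₁ (decide (IsLeaf τ₁))

    W-witness : ∀ τ₁ → IsLeaf τ₁ → Witness (W τ₁) τ₁ (S τ₁)
    W-witness τ₁ l with decide (IsLeaf τ₁)
    ... | yes l' = proj₂ (witnessAt τ₁ l')
    ... | no ¬l = ⊥-elim (¬l l)

    W-finite : ∀ τ₁ → FinitePair (W τ₁)
    W-finite τ₁ with decide (IsLeaf τ₁)
    ... | yes l = finite (system (proj₂ (witnessAt τ₁ l)))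
    ... | no _ = [] , λ _ _ ()

    W-isLeaf : ∀ {τ₁ τ ρ} → W τ₁ τ ρ → IsLeaf τ₁
    W-isLeaf {τ₁} w with decide (IsLeaf τ₁)
    ... | yes l = l
    ... | no _ = ⊥-elim w

    leafOf : ∀ {τ₁ τ} → dom (W τ₁) τ → IsLeaf τ₁
    leafOf (_ , w) = W-isLeaf w

    W-system : ∀ {τ₁ τ} → dom (W τ₁) τ → BushySystem (W τ₁) τ₁ μ
    W-system {τ₁} d = system (W-witness τ₁ (leafOf d))

    rootOf : ∀ {τ₁ τ} → dom (W τ₁) τ → τ₁ ≼ τ
    rootOf {τ = τ} d = tree-above (domTree (W-system d)) τ d

    nonLeaf-notAbove : ∀ {τ₁ τ} → IsLeaf τ₁ → τ₁ ≼ τ → dom S τ → ¬ IsLeaf τ → ⊥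
    nonLeaf-notAbove l p d ¬l = ¬l (subst IsLeaf (sym (proj₂ l _ d p)) l)

    sameGraft : ∀ {τ₁ τ₂ x y} → dom (W τ₁) x → dom (W τ₂) y → x ≼ y → τ₁ ≡ τ₂
    sameGraft d₁ d₂ x≼y = leaf-unique (dom S) (leafOf d₁) (leafOf d₂) (≼-trans (rootOf d₁) x≼y) (rootOf d₂)

    G : PairSet
    G τ ρ = (S τ ρ × ¬ IsLeaf τ) ⊎ Σ Str λ τ₁ → W τ₁ τ ρ

    data Region (τ : Str) : Set where
      inBase  : dom S τ → ¬ IsLeaf τ → Region τ
      inGraft : ∀ τ₁ → dom (W τ₁) τ → Region τ

    region : ∀ {τ} → dom G τ → Region τ
    region (ρ , inj₁ (s , ¬l)) = inBase (ρ , s) ¬l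
    region (ρ , inj₂ (τ₁ , w)) = inGraft τ₁ (ρ , w)

    -- Conversely points of S and of the grafts are domain points of G
    -- (a leaf of S is the root of its graft).
    base→G : ∀ {τ} → dom S τ → dom G τ
    base→G {τ} (ρ , s) with decide (IsLeaf τ)
    ... | no ¬l = ρ , inj₁ (s , ¬l)
    ... | yes l = let (ρ' , w) = tree-root (domTree (system (W-witness τ l))) in ρ' , inj₂ (τ , w)

    graft→G : ∀ {τ₁ τ} → dom (W τ₁) τ → dom G τ
    graft→G {τ₁} (ρ , w) = ρ , inj₂ (τ₁ , w)

    G≐S : ∀ {τ} → dom S τ → ¬ IsLeaf τ → G τ ≐ S τ
    G≐S {τ} d ¬l ρ = fromG , (λ s → inj₁ (s , ¬l))
      where
      fromG : G τ ρ → S τ ρ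
      fromG (inj₁ (s , _)) = s
      fromG (inj₂ (τ₁ , w)) = ⊥-elim (nonLeaf-notAbove (W-isLeaf w) (rootOf (ρ , w)) d ¬l)

    G≐W : ∀ {τ₁ τ} → dom (W τ₁) τ → G τ ≐ W τ₁ τ
    G≐W {τ₁} {τ} d ρ = fromG , (λ w → inj₂ (τ₁ , w))
      where
      fromG : G τ ρ → W τ₁ τ ρ
      fromG (inj₁ (s , ¬l)) = ⊥-elim (nonLeaf-notAbove (leafOf d) (rootOf d) (ρ , s) ¬l)
      fromG (inj₂ (τ₂ , w)) = subst (λ t → W t τ ρ) (sameGraft (ρ , w) d (≼-refl τ)) w

    G-domTree : IsTreeAbove (dom G) τ₀
    G-domTree = (τ₀ , base→G (tree-root (domTree sys))) , aboveRoot , closed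
      where
      aboveRoot : ∀ τ → dom G τ → τ₀ ≼ τ
      aboveRoot τ d with region d
      ... | inBase dS _ = tree-above (domTree sys) τ dS
      ... | inGraft τ₁ dW = ≼-trans (tree-above (domTree sys) τ₁ (proj₁ (leafOf dW))) (rootOf dW)
      closed : ∀ τ τ' → dom G τ' → τ ≼ τ' → length τ₀ ≤ length τ → dom G τ
      closed τ τ' d' p l with region d'
      ... | inBase dS _ = base→G (tree-closed (domTree sys) τ τ' dS p l)
      ... | inGraft τ₁ dW with ≤-total (length τ₁) (length τ)
      ...   | inj₁ le = graft→G {τ₁} (tree-closed (domTree (W-system dW)) τ τ' dW p le)
      ...   | inj₂ le = base→G (tree-closed (domTree sys) τ τ₁ (proj₁ (leafOf dW))
                                  (≼-comparable τ τ₁ p (rootOf dW) le) l)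

    G-fibres : ∀ τ → dom G τ → IsTreeAbove (G τ) μ × FiniteStr (G τ)
    G-fibres τ d with region d
    ... | inBase dS ¬l = Tree-≐ (≐-sym (G≐S dS ¬l)) (fibreTree sys τ dS) ,
                       Finite-≐ (≐-sym (G≐S dS ¬l)) (fibreFinite sys τ dS)
    ... | inGraft τ₁ dW = Tree-≐ (≐-sym (G≐W dW)) (fibreTree (W-system dW) τ dW) ,
                        Finite-≐ (≐-sym (G≐W dW)) (fibreFinite (W-system dW) τ dW)

    -- From a base point τ to a graft point τ' the fibre grows in three steps:
    -- S τ ⊑ S τ₁ ⊑ W τ₁ τ₁ ⊑ W τ₁ τ', where τ₁ is the leaf below τ'.
    G-extends : ∀ τ τ' → dom G τ → dom G τ' → τ ≼ τ' → τ ≢ τ' → EndExtends (G τ') (G τ)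
    G-extends τ τ' d d' p τ≢τ' with region d' | region d
    ... | inBase dS' ¬l' | inBase dS ¬l =
          EndExtends-≐ (≐-sym (G≐S dS' ¬l')) (≐-sym (G≐S dS ¬l)) (fibreExtends sys τ τ' dS dS' p τ≢τ')
    ... | inBase dS' ¬l' | inGraft τ₁ dW = ⊥-elim (nonLeaf-notAbove (leafOf dW) (≼-trans (rootOf dW) p) dS' ¬l')
    ... | inGraft τ₁ dW' | inBase dS ¬l = EndExtends-≐ (≐-sym (G≐W dW')) (≐-sym (G≐S dS ¬l))
          (EndExtends-trans (extends-≼ (fibreExtends sys') τ₁ τ' (tree-root (domTree sys')) dW' (rootOf dW'))
            (EndExtends-trans (rootExtends (W-witness τ₁ l₁)) (fibreExtends sys τ τ₁ dS (proj₁ l₁) τ≼τ₁ τ≢τ₁)))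
      where
      l₁ = leafOf dW'
      sys' = W-system dW'
      τ≼τ₁ : τ ≼ τ₁
      τ≼τ₁ with ≤-total (length τ₁) (length τ)
      ... | inj₁ le = ⊥-elim (nonLeaf-notAbove l₁ (≼-comparable τ₁ τ (rootOf dW') p le) dS ¬l)
      ... | inj₂ le = ≼-comparable τ τ₁ p (rootOf dW') le
      τ≢τ₁ : τ ≢ τ₁
      τ≢τ₁ e = ¬l (subst IsLeaf (sym e) l₁)
    ... | inGraft τ₁ dW' | inGraft τ₂ dW = EndExtends-≐ (≐-sym (G≐W dW')) (≐-sym (G≐W dWτ))
          (fibreExtends (W-system dW') τ τ' dWτ dW' p τ≢τ')
      where
      dWτ : dom (W τ₁) τ
      dWτ = subst (λ t → dom (W t) τ) (sameGraft dW dW' p) dW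

    graftLeaf→G : ∀ {τ₁ τ} (dW : dom (W τ₁) τ) → Leaf (dom (W τ₁)) τ → Leaf (dom G) τ
    graftLeaf→G {τ₁} {τ} dW leaf = graft→G {τ₁} dW , maximal
      where
      maximal : ∀ y → dom G y → τ ≼ y → y ≡ τ
      maximal y dy p with region dy
      ... | inBase dS ¬l = ⊥-elim (nonLeaf-notAbove (leafOf dW) (≼-trans (rootOf dW) p) dS ¬l)
      ... | inGraft τ₂ dW₂ = proj₂ leaf y (subst (λ t → dom (W t) y) (sym (sameGraft dW dW₂ p)) dW₂) p

    G-domBushy : Bushy b (dom G)
    G-domBushy τ d ¬leaf with region d
    ... | inBase dS ¬l =
          AtLeast-map {P = λ n → dom S (τ ++ [ n ])} {Q = λ n → dom G (τ ++ [ n ])}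
            (λ n → base→G) (domBushy sys τ dS ¬l)
    ... | inGraft τ₁ dW =
          AtLeast-map {P = λ n → dom (W τ₁) (τ ++ [ n ])} {Q = λ n → dom G (τ ++ [ n ])}
            (λ n → graft→G {τ₁}) (domBushy (W-system dW) τ dW (λ l → ¬leaf (graftLeaf→G dW l)))

    G-fibreBushy : ∀ τ → dom G τ → Bushy c (G τ)
    G-fibreBushy τ d with region d
    ... | inBase dS ¬l = Bushy-≐ {c} (≐-sym (G≐S dS ¬l)) (fibreBushy sys τ dS)
    ... | inGraft τ₁ dW = Bushy-≐ {c} (≐-sym (G≐W dW)) (fibreBushy (W-system dW) τ dW)

    G-finite : FinitePair G
    G-finite = L ++ concatMap graftList (map proj₁ L) , covers
      where
      L = proj₁ (finite sys)
      graftList : Str → List (Str × Str)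
      graftList τ₁ = proj₁ (W-finite τ₁)
      covers : ∀ τ ρ → G τ ρ → (τ , ρ) ∈ L ++ concatMap graftList (map proj₁ L)
      covers τ ρ (inj₁ (s , _)) = ∈-++⁺ˡ (proj₂ (finite sys) τ ρ s)
      covers τ ρ (inj₂ (τ₁ , w)) = ∈-++⁺ʳ L (∈-concatMap graftList τ₁∈ (proj₂ (W-finite τ₁) τ ρ w))
        where
        τ₁∈ = let (ρ₁ , s₁) = proj₁ (W-isLeaf w) in ∈-map⁺ proj₁ (proj₂ (finite sys) τ₁ ρ₁ s₁)

    -- The domain leaves of G are those of the grafts.
    G-leavesInB : LeavesIn B G
    G-leavesInB τ ρ (leafG , leafρ) with region (proj₁ leafG)
    ... | inBase dS ¬l = ⊥-elim (¬l (dS , λ y dy p → proj₂ leafG y (base→G dy) p))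
    ... | inGraft τ₁ dW = leavesInB (W-witness τ₁ (leafOf dW)) τ ρ
          ((dW , λ y dy p → proj₂ leafG y (graft→G {τ₁} dy) p) , Leaf-≐ (G≐W dW) leafρ)

    G-rootExtends : EndExtends (G τ₀) (S τ₀)
    G-rootExtends with decide (IsLeaf τ₀)
    ... | no ¬l = EndExtends-≐ (≐-sym (G≐S (tree-root (domTree sys)) ¬l)) ≐-refl EndExtends-refl
    ... | yes l = EndExtends-≐ (≐-sym (G≐W (tree-root (domTree (system (W-witness τ₀ l)))))) ≐-refl
                    (rootExtends (W-witness τ₀ l))

    graft : BigOver τ₀ (S τ₀)
    graft = G , record
      { system = record
          { finite = G-finite ; domTree = G-domTree ; fibres = G-fibres ; fibreExtends = G-extends
          ; domBushy = G-domBushy ; fibreBushy = G-fibreBushy }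
      ; leavesInB = G-leavesInB
      ; rootExtends = G-rootExtends }

  -- Adding R to every fibre of S gives a
  -- system above (τ , μ) whose root fibre end-extends R, so witnesses over its
  -- fibres at the domain leaves yield, by grafting, a witness over R.
  module Widening {R : StrSet} {ρ* : Str} (tR : IsTreeAbove R μ) (lR : Leaf R ρ*) where

    -- A leaf of a tree X above ρ* stays a leaf in R ∪ X, since R ends at ρ*.
    leaf→∪ : ∀ {X} → IsTreeAbove X ρ* → ∀ {ℓ} → Leaf X ℓ → Leaf (R ∪ X) ℓ
    leaf→∪ {X} tX {ℓ} (xℓ , maximal) = inj₂ xℓ , maximal∪
      where
      maximal∪ : ∀ y → (R ∪ X) y → ℓ ≼ y → y ≡ ℓ
      maximal∪ y (inj₂ xy) p = maximal y xy p
      maximal∪ y (inj₁ ry) p =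
        let y≡ρ* = proj₂ lR y ry (≼-trans (tree-above tX ℓ xℓ) p)
        in trans y≡ρ* (sym (≼-antisym (subst (ℓ ≼_) y≡ρ* p) (tree-above tX ℓ xℓ)))

    ∪-tree : ∀ {X} → IsTreeAbove X ρ* → IsTreeAbove (R ∪ X) μ
    ∪-tree {X} tX = (proj₁ (proj₁ tR) , inj₁ (proj₂ (proj₁ tR))) , aboveμ , closed
      where
      aboveμ : ∀ x → (R ∪ X) x → μ ≼ x
      aboveμ x (inj₁ r) = tree-above tR x r
      aboveμ x (inj₂ xx) = ≼-trans (tree-above tR ρ* (proj₁ lR)) (tree-above tX x xx)
      closed : ∀ y x → (R ∪ X) x → y ≼ x → length μ ≤ length y → (R ∪ X) y
      closed y x (inj₁ r) p l = inj₁ (tree-closed tR y x r p l)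
      closed y x (inj₂ xx) p l with ≤-total (length ρ*) (length y)
      ... | inj₁ le = inj₂ (tree-closed tX y x xx p le)
      ... | inj₂ le = inj₁ (tree-closed tR y ρ* (proj₁ lR) (≼-comparable y ρ* p (tree-above tX x xx) le) l)

    -- Above ρ* the successors come from X, elsewhere from R.
    ∪-bushy : ∀ {X} → IsTreeAbove X ρ* → Bushy c R → Bushy c X → Bushy c (R ∪ X)
    ∪-bushy {X} tX bR bX x ux ¬leaf with decide (ρ* ≼ x)
    ... | yes ρ*≼x = AtLeast-map {P = λ n → X (x ++ [ n ])} {Q = λ n → (R ∪ X) (x ++ [ n ])}
                       (λ n → inj₂) (bX x inX (λ l → ¬leaf (leaf→∪ tX l)))
      where
      toX : (R ∪ X) x → X x
      toX (inj₂ xx) = xx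
      toX (inj₁ r) = subst X (sym (proj₂ lR x r ρ*≼x)) (tree-root tX)
      inX = toX ux
    ... | no ρ*⋠x = AtLeast-map {P = λ n → R (x ++ [ n ])} {Q = λ n → (R ∪ X) (x ++ [ n ])}
                      (λ n → inj₁) (bR x inR (λ l → ¬leaf (leafR→∪ l)))
      where
      toR : (R ∪ X) x → R x
      toR (inj₁ r) = r
      toR (inj₂ xx) = ⊥-elim (ρ*⋠x (tree-above tX x xx))
      inR = toR ux
      leafR→∪ : Leaf R x → Leaf (R ∪ X) x
      leafR→∪ (rx , maximal) = inj₁ rx , maximal∪
        where
        maximal∪ : ∀ y → (R ∪ X) y → x ≼ y → y ≡ x
        maximal∪ y (inj₁ ry) q = maximal y ry q
        maximal∪ y (inj₂ xy) q with ≤-total (length ρ*) (length x)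
        ... | inj₁ le = ⊥-elim (ρ*⋠x (≼-comparable ρ* x (tree-above tX y xy) q le))
        ... | inj₂ le = ⊥-elim (ρ*⋠x (subst (ρ* ≼_)
                          (maximal ρ* (proj₁ lR) (≼-comparable x ρ* q (tree-above tX y xy) le)) (≼-refl ρ*)))

    ∪-extends : ∀ {X X'} → IsTreeAbove X ρ* → EndExtends X' X → EndExtends (R ∪ X') (R ∪ X)
    ∪-extends {X} {X'} tX (X⊆X' , newX') = sub , new
      where
      sub : ∀ x → (R ∪ X) x → (R ∪ X') x
      sub x (inj₁ r) = inj₁ r
      sub x (inj₂ xx) = inj₂ (X⊆X' x xx)
      new : ∀ x → (R ∪ X') x → ¬ (R ∪ X) x → ∃ λ ℓ → Leaf (R ∪ X) ℓ × ℓ ≼ x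
      new x (inj₁ r) ¬old = ⊥-elim (¬old (inj₁ r))
      new x (inj₂ x') ¬old =
        let (ℓ , leaf , p) = newX' x x' (λ xx → ¬old (inj₂ xx)) in ℓ , leaf→∪ tX leaf , p

    ∪-extendsR : ∀ {X} → IsTreeAbove X ρ* → EndExtends (R ∪ X) R
    ∪-extendsR {X} tX = (λ x r → inj₁ r) , new
      where
      new : ∀ x → (R ∪ X) x → ¬ R x → ∃ λ ℓ → Leaf R ℓ × ℓ ≼ x
      new x (inj₁ r) ¬r = ⊥-elim (¬r r)
      new x (inj₂ xx) _ = ρ* , lR , tree-above tX x xx

    widened-dom : ∀ {S} → dom (widened R S) ≐ dom S
    widened-dom τ' = (λ (_ , d , _) → d) , (λ d → proj₁ (proj₁ tR) , d , inj₁ (proj₂ (proj₁ tR)))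

    widened-system : ∀ {S τ} → FiniteStr R → Bushy c R → BushySystem S τ ρ* →
                     BushySystem (widened R S) τ μ
    widened-system {S} {τ} fR bR sys = record
      { finite = pairsOver (map proj₁ LS) (λ _ → proj₁ fR) ++ LS , covers
      ; domTree = Tree-≐ (≐-sym (widened-dom {S})) (domTree sys)
      ; fibres = λ τ' d' → let d = proj₁ (widened-dom {S} τ') d' in
          Tree-≐ (≐-sym (widened≐ {R} {S} d)) (∪-tree (fibreTree sys τ' d)) ,
          Finite-≐ (≐-sym (widened≐ {R} {S} d)) (∪-finite fR (fibreFinite sys τ' d))
      ; fibreExtends = λ τ₁ τ₂ d₁' d₂' p τ₁≢τ₂ →
          let d₁ = proj₁ (widened-dom {S} τ₁) d₁' ; d₂ = proj₁ (widened-dom {S} τ₂) d₂' in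
          EndExtends-≐ (≐-sym (widened≐ {R} {S} d₂)) (≐-sym (widened≐ {R} {S} d₁))
            (∪-extends (fibreTree sys τ₁ d₁) (fibreExtends sys τ₁ τ₂ d₁ d₂ p τ₁≢τ₂))
      ; domBushy = Bushy-≐ {b} (≐-sym (widened-dom {S})) (domBushy sys)
      ; fibreBushy = λ τ' d' → let d = proj₁ (widened-dom {S} τ') d' in
          Bushy-≐ {c} (≐-sym (widened≐ {R} {S} d)) (∪-bushy (fibreTree sys τ' d) bR (fibreBushy sys τ' d)) }
      where
      LS = proj₁ (finite sys)
      covers : ∀ τ' ρ → widened R S τ' ρ → (τ' , ρ) ∈ pairsOver (map proj₁ LS) (λ _ → proj₁ fR) ++ LS
      covers τ' ρ ((ρ' , s') , inj₁ r) =
        ∈-++⁺ˡ (∈-pairsOver {τs = map proj₁ LS} (∈-map⁺ proj₁ (proj₂ (finite sys) τ' ρ' s')) (proj₂ fR ρ r))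
      covers τ' ρ (_ , inj₂ s) = ∈-++⁺ʳ (pairsOver (map proj₁ LS) (λ _ → proj₁ fR)) (proj₂ (finite sys) τ' ρ s)

    widen : ∀ {S τ} → FiniteStr R → Bushy c R → (sys : BushySystem S τ ρ*) →
            (∀ τ₁ → Leaf (dom (widened R S)) τ₁ → BigOver τ₁ (widened R S τ₁)) → BigOver τ R
    widen {S} {τ} fR bR sys witnessAt =
      BigOver-weaken extendsR (Grafting.graft (widened-system fR bR sys) witnessAt)
      where
      dτ = tree-root (domTree sys)
      extendsR : EndExtends (widened R S τ) R
      extendsR = EndExtends-≐ (≐-sym (widened≐ {R} {S} dτ)) ≐-refl (∪-extendsR (fibreTree sys τ dτ))

module Resolution (em : ExcludedMiddle (lsuc 0ℓ)) (b c : ℕ → ℕ) {B T : PairSet} {σ μ : Str}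
    (tsT : IsTreeSystem T σ μ) (B⊆T : B ⊆₂ T) (B-open : OpenIn B T) (m' : ℕ)
    (bigAbove : ∀ τ ρ → T τ ρ → m' ≤ length τ → m' ≤ length ρ → Big b c B τ ρ) where
  open Classical em
  open Systems b c
  open Witnesses em b c B μ

  T-grows : ∀ {τ τ₁} → dom T τ → dom T τ₁ → τ ≼ τ₁ → ∀ {ρ} → T τ ρ → T τ₁ ρ
  T-grows {τ} {τ₁} d d₁ p {ρ} t = proj₁ (extends-≼ (proj₂ (proj₂ tsT)) τ τ₁ d d₁ p) ρ t

  Pending : List Str → Str → StrSet → Set
  Pending L τ R = ∀ ρ → Leaf R ρ → T τ ρ × ((ρ ∈ L × m' ≤ length ρ) ⊎ B τ ρ)

  pending-skip : ∀ {ρ* L τ R} → Pending (ρ* ∷ L) τ R → (Leaf R ρ* → B τ ρ*) → Pending L τ R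
  pending-skip pend done ρ leaf with pend ρ leaf
  ... | t , inj₂ inB = t , inj₂ inB
  ... | t , inj₁ (there ρ∈L , long) = t , inj₁ (ρ∈L , long)
  ... | t , inj₁ (here refl , _) = t , inj₂ (done leaf)

  -- After widening R by a system S above (τ , ρ*) with leaves in B, at a domain
  -- leaf τ₁ of S only the leaves listed in L are pending: new leaves are leaves
  -- of S, hence in B, and the old leaves other than ρ* keep their status, B being open.
  pending-widen : ∀ {L τ R ρ* S τ₁} → BushySystem S τ ρ* → LeavesIn B S →
    Pending (ρ* ∷ L) τ R → dom T τ → Leaf (dom S) τ₁ → dom T τ₁ → Pending L τ₁ (widened R S τ₁)
  pending-widen {L} {τ} {R} {ρ*} {S} {τ₁} sys inB pend dτ leaf₁ dτ₁ ρ leaf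
    with widened-leaf {R} {S} (proj₁ leaf₁) leaf
  ... | inj₁ leafS = let inBρ = inB τ₁ ρ (leaf₁ , leafS) in B⊆T τ₁ ρ inBρ , inj₂ inBρ
  ... | inj₂ (leafR , ρ∉S) with pend ρ leafR
  ...   | t , status = T-grows dτ dτ₁ τ≼τ₁ t , carry status
    where
    τ≼τ₁ = tree-above (domTree sys) τ₁ (proj₁ leaf₁)
    carry : (ρ ∈ ρ* ∷ L × m' ≤ length ρ) ⊎ B τ ρ → (ρ ∈ L × m' ≤ length ρ) ⊎ B τ₁ ρ
    carry (inj₁ (here ρ≡ρ* , _)) =
      ⊥-elim (ρ∉S (subst (S τ₁) (sym ρ≡ρ*) (tree-root (fibreTree sys τ₁ (proj₁ leaf₁)))))
    carry (inj₁ (there ρ∈L , long)) = inj₁ (ρ∈L , long)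
    carry (inj₂ inBτ) = inj₂ (B-open τ ρ τ₁ ρ inBτ (T-grows dτ dτ₁ τ≼τ₁ t) τ≼τ₁ (≼-refl ρ))

  -- A pending leaf ρ* outside B is
  -- long, so B is big above (τ , ρ*); widening R by such a system S leaves,
  -- at each domain leaf τ₁ of S, one pending leaf fewer.
  resolve : ∀ L τ R → dom T τ → m' ≤ length τ →
            IsTreeAbove R μ → FiniteStr R → Bushy c R → Pending L τ R → BigOver τ R
  resolve [] τ R _ _ tR fR bR pend = singleton τ tR fR bR (λ ρ leaf → noneLeft (proj₂ (pend ρ leaf)))
    where
    noneLeft : ∀ {ρ} → (ρ ∈ [] × m' ≤ length ρ) ⊎ B τ ρ → B τ ρ
    noneLeft (inj₂ inB) = inB
    noneLeft (inj₁ (() , _))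
  resolve (ρ* ∷ L) τ R dτ long tR fR bR pend with decide (Leaf R ρ*)
  ... | no ¬leaf = resolve L τ R dτ long tR fR bR (pending-skip pend (λ l → ⊥-elim (¬leaf l)))
  ... | yes lR with pend ρ* lR
  ...   | _ , inj₂ inB = resolve L τ R dτ long tR fR bR (pending-skip pend (λ _ → inB))
  ...   | t* , inj₁ (_ , long*) = Widening.widen tR lR fR bR sysS witnessAt
    where
    bigS = big→system (bigAbove τ ρ* t* long long*)
    S = proj₁ bigS
    sysS = proj₁ (proj₂ bigS)
    inBS = proj₂ (proj₂ bigS)
    sys' = Widening.widened-system tR lR fR bR sysS
    witnessAt : ∀ τ₁ → Leaf (dom (widened R S)) τ₁ → BigOver τ₁ (widened R S τ₁)
    witnessAt τ₁ leaf' =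
      resolve L τ₁ (widened R S τ₁) dτ₁ long₁ (fibreTree sys' τ₁ d') (fibreFinite sys' τ₁ d')
        (fibreBushy sys' τ₁ d') (pending-widen sysS inBS pend dτ leaf₁ dτ₁)
      where
      d' = proj₁ leaf'
      leaf₁ : Leaf (dom S) τ₁
      leaf₁ = Leaf-≐ (Widening.widened-dom tR lR {S}) leaf'
      long₁ = ≤-trans long (≼⇒length≤ (tree-above (domTree sysS) τ₁ (proj₁ leaf₁)))
      -- τ₁ ∈ dom T: the fibre S τ₁ has a leaf, and leaves of S lie in B ⊆ T.
      dτ₁ : dom T τ₁
      dτ₁ = let (ρ₁ , leafρ₁ , _) = leafAbove (S τ₁) (fibreFinite sysS τ₁ (proj₁ leaf₁)) ρ*
                                      (tree-root (fibreTree sysS τ₁ (proj₁ leaf₁)))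
            in ρ₁ , B⊆T τ₁ ρ₁ (inBS τ₁ ρ₁ (leaf₁ , leafρ₁))

-- Since T is bounded the
-- result is finite, its domain leaves are the points of length m' (T has no
-- domain leaves and b ≥ 2), and there all fibre leaves have length m' too; so
-- resolving these fibres and grafting shows that B is big above (σ , μ).
module Truncation (em : ExcludedMiddle (lsuc 0ℓ)) (b c : ℕ → ℕ) (hb : IsBoundingFunction b)
    {B T : PairSet} {σ μ : Str} (tsT : IsTreeSystem T σ μ) (bT : Bushy2 b c T)
    (bdd : BoundedSys T) (noLeaf : ∀ τ → ¬ Leaf (dom T) τ)
    (B⊆T : B ⊆₂ T) (B-open : OpenIn B T) (m' : ℕ) (balanced : BalancedLevel T m') (σ≤m' : length σ ≤ m')
    (bigAbove : ∀ τ ρ → T τ ρ → m' ≤ length τ → m' ≤ length ρ → Big b c B τ ρ) where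
  open Classical em
  open Systems b c
  open Witnesses em b c B μ
  open Resolution em b c tsT B⊆T B-open m' bigAbove

  T-fibres : ∀ τ → dom T τ → IsTreeAbove (T τ) μ × FiniteStr (T τ)
  T-fibres = proj₁ (proj₂ tsT)

  Tm : PairSet
  Tm τ ρ = T τ ρ × length τ ≤ m'

  Tm≐T : ∀ {τ} → length τ ≤ m' → Tm τ ≐ T τ
  Tm≐T le ρ = proj₁ , (λ t → t , le)

  domTm : ∀ {τ} → dom Tm τ → dom T τ × length τ ≤ m'
  domTm (ρ , t , le) = (ρ , t) , le

  fibreList : ∀ τ → FiniteStr (T τ)
  fibreList τ with decide (dom T τ)
  ... | yes d = proj₂ (T-fibres τ d)
  ... | no ¬d = [] , λ ρ t → ⊥-elim (¬d (ρ , t))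

  Tm-finite : FinitePair Tm
  Tm-finite = pairsOver (boundedStrings g m') (λ τ → proj₁ (fibreList τ)) , covers
    where
    g = proj₁ bdd
    covers : ∀ τ ρ → Tm τ ρ → (τ , ρ) ∈ pairsOver (boundedStrings g m') (λ τ' → proj₁ (fibreList τ'))
    covers τ ρ (t , le) =
      ∈-pairsOver (boundedStrings-complete g m' τ le (proj₁ (proj₂ bdd τ ρ t))) (proj₂ (fibreList τ) ρ t)

  Tm-domTree : IsTreeAbove (dom Tm) σ
  Tm-domTree = (σ , proj₁ dσ , proj₂ dσ , σ≤m') , (λ τ d → tree-above (proj₁ tsT) τ (proj₁ (domTm d))) , closed
    where
    dσ = tree-root (proj₁ tsT)
    closed : ∀ y τ → dom Tm τ → y ≼ τ → length σ ≤ length y → dom Tm y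
    closed y τ d p l = let (ρ , t) = tree-closed (proj₁ tsT) y τ (proj₁ (domTm d)) p l
                       in ρ , t , ≤-trans (≼⇒length≤ p) (proj₂ (domTm d))

  successors : ∀ τ → dom Tm τ → length τ < m' → AtLeast (b (length τ)) (λ n → dom Tm (τ ++ [ n ]))
  successors τ d lt =
    AtLeast-map {P = λ n → dom T (τ ++ [ n ])} {Q = λ n → dom Tm (τ ++ [ n ])}
      (λ n (ρ , t) → ρ , t , subst (_≤ m') (sym (length-snoc τ n)) lt)
      (proj₁ bT τ (proj₁ (domTm d)) (noLeaf τ))

  leafAtLevel : ∀ τ → dom Tm τ → length τ ≡ m' → Leaf (dom Tm) τ
  leafAtLevel τ d e = d , λ y dy p → sym (≼∧length≥⇒≡ p (subst (length y ≤_) (sym e) (proj₂ (domTm dy))))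

  leafLength : ∀ τ → Leaf (dom Tm) τ → length τ ≡ m'
  leafLength τ leaf with length τ <? m'
  ... | no ≮m' = ≤-antisym (proj₂ (domTm (proj₁ leaf))) (≮⇒≥ ≮m')
  ... | yes <m' = ⊥-elim (1+n≢n (trans (sym (length-snoc τ (f i₀))) (cong length τn≡τ)))
    where
    i₀ : Fin (b (length τ))
    i₀ = fromℕ< (≤-trans (s≤s z≤n) (hb (length τ)))
    f = proj₁ (successors τ (proj₁ leaf) <m')
    τn≡τ : τ ++ [ f i₀ ] ≡ τ
    τn≡τ = proj₂ leaf (τ ++ [ f i₀ ]) (proj₂ (proj₂ (successors τ (proj₁ leaf) <m')) i₀) (≼-snoc τ (f i₀))

  Tm-domBushy : Bushy b (dom Tm)
  Tm-domBushy τ d ¬leaf with length τ <? m'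
  ... | yes <m' = successors τ d <m'
  ... | no ≮m' = ⊥-elim (¬leaf (leafAtLevel τ d (≤-antisym (proj₂ (domTm d)) (≮⇒≥ ≮m'))))

  truncated : BushySystem Tm σ μ
  truncated = record
    { finite = Tm-finite
    ; domTree = Tm-domTree
    ; fibres = λ τ d → let (dT , le) = domTm d ; (tree , fin) = T-fibres τ dT in
        Tree-≐ (≐-sym (Tm≐T le)) tree , Finite-≐ (≐-sym (Tm≐T le)) fin
    ; fibreExtends = λ τ τ' d d' p τ≢τ' →
        EndExtends-≐ (≐-sym (Tm≐T (proj₂ (domTm d')))) (≐-sym (Tm≐T (proj₂ (domTm d))))
          (proj₂ (proj₂ tsT) τ τ' (proj₁ (domTm d)) (proj₁ (domTm d')) p τ≢τ')
    ; domBushy = Tm-domBushy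
    ; fibreBushy = λ τ d → Bushy-≐ {c} (≐-sym (Tm≐T (proj₂ (domTm d)))) (proj₂ bT τ (proj₁ (domTm d))) }

  -- At a domain leaf τ₁ the fibre leaves have length m' (the level is balanced),
  -- so all of them are pending and the fibre can be resolved.
  resolveLeaf : ∀ τ₁ → Leaf (dom Tm) τ₁ → BigOver τ₁ (Tm τ₁)
  resolveLeaf τ₁ leaf =
    resolve (proj₁ fin₁) τ₁ (Tm τ₁) dT₁ (≤-reflexive (sym atLevel))
      (Tree-≐ (≐-sym eq) tree₁) (Finite-≐ (≐-sym eq) fin₁) (Bushy-≐ {c} (≐-sym eq) (proj₂ bT τ₁ dT₁)) pending
    where
    dT₁ = proj₁ (domTm (proj₁ leaf))
    atLevel = leafLength τ₁ leaf
    eq = Tm≐T (proj₂ (domTm (proj₁ leaf)))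
    tree₁ = proj₁ (T-fibres τ₁ dT₁)
    fin₁ = proj₂ (T-fibres τ₁ dT₁)
    pending : Pending (proj₁ fin₁) τ₁ (Tm τ₁)
    pending ρ leafρ = let leafT = Leaf-≐ eq leafρ in
      proj₁ leafT , inj₁ (proj₂ fin₁ ρ (proj₁ leafT) , ≤-reflexive (sym (balanced τ₁ dT₁ atLevel ρ leafT)))

  bigAtRoot : Big b c B σ μ
  bigAtRoot = let (_ , w) = Grafting.graft truncated resolveLeaf in system→big (system w) (leavesInB w)

lemma3p17 : ExcludedMiddle (lsuc 0ℓ) →
    (b c : ℕ → ℕ) → IsBoundingFunction b → IsBoundingFunction c →
    (T : PairSet) (σ μ : Str) →
    IsTreeSystem T σ μ → BoundedSys T → Balanced T → Bushy2 b c T →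
    (B : PairSet) → B ⊆₂ T → OpenIn B T → Small b c B σ μ →
    (m : ℕ) → ∃ λ τ → ∃ λ ρ →
      T τ ρ × m ≤ length τ × m ≤ length ρ × Small b c B τ ρ
lemma3p17 em b c hb _ T σ μ tsT bdd (noLeaf , levels) bT B B⊆T B-open small m
  with em {∃ λ τ → ∃ λ ρ → T τ ρ × m ≤ length τ × m ≤ length ρ × Small b c B τ ρ}
... | yes found = found
... | no none = ⊥-elim (small (Truncation.bigAtRoot em b c hb tsT bT bdd noLeaf B⊆T B-open
                                 m' balanced σ≤m' bigAbove))
  where
  level = levels (m + length σ)
  m' = proj₁ level
  balanced = proj₂ (proj₂ level)
  m≤m' = ≤-trans (m≤m+n m (length σ)) (proj₁ (proj₂ level))
  σ≤m' = ≤-trans (m≤n+m (length σ) m) (proj₁ (proj₂ level))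
  bigAbove : ∀ τ ρ → T τ ρ → m' ≤ length τ → m' ≤ length ρ → Big b c B τ ρ
  bigAbove τ ρ t l₁ l₂ =
    Classical.¬¬-elim em (λ small' → none (τ , ρ , t , ≤-trans m≤m' l₁ , ≤-trans m≤m' l₂ , small'))
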